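{- Let $n$ be a positive integer, let $\mu=\{\mu_k\}_{k=0}^\infty$ be a sequence of complex numbers, and let $$\gamma_k=\sum_{j=0}^{\lfloor k/2\rfloor}\binom{k}{j}\mu_{k-2j},\qquad k\in\mathbb{N}.$$ For variables $\mathbf{z}=(z_1,\dots,z_n)$ let $e_k(\mathbf{z})$ denote the $k$-th elementary symmetric function (with $e_k=0$ for $k\notin\{0,\dots,n\}$), and set $$W_{\mu,n}(\mathbf{z})=\sum_{0\le i\le j\le n}\mu_{j-i}\,e_i(\mathbf{z})e_j(\mathbf{z}).$$ Then $$W_{\mu,n}(\mathbf{z})=e_n(\mathbf{z})\sum_{k=0}^n\gamma_k\, e_{n-k}\!\left(z_1+\tfrac{1}{z_1},\dots,z_n+\tfrac{1}{z_n}\right).$$ -}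

module Defs where

open import Level using (Level)
open import Data.Nat using (ℕ; zero; suc; _∸_; _≤_; ⌊_/2⌋) renaming (_+_ to _+ℕ_; _*_ to _*ℕ_)
open import Data.Nat.Combinatorics using (_C_)
open import Data.Vec using (Vec; []; _∷_)
open import Algebra.Bundles using (CommutativeRing)

module _ {c ℓ : Level} (R : CommutativeRing c ℓ) where
  open CommutativeRing R

  fromℕ : ℕ → Carrier
  fromℕ zero = 0#
  fromℕ (suc n) = 1# + fromℕ n

  sumTo : ℕ → (ℕ → Carrier) → Carrier
  sumTo zero f = f 0
  sumTo (suc m) f = sumTo m f + f (suc m)

  esym : {n : ℕ} → ℕ → Vec Carrier n → Carrier
  esym zero _ = 1#
  esym (suc k) [] = 0#
  esym (suc k) (x ∷ xs) = esym (suc k) xs + x * esym k xs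

  gamma : (ℕ → Carrier) → ℕ → Carrier
  gamma μ k = sumTo ⌊ k /2⌋ (λ j → fromℕ (k C j) * μ (k ∸ (2 *ℕ j)))

  W : (ℕ → Carrier) → (n : ℕ) → Vec Carrier n → Carrier
  W μ n z = sumTo n (λ j → sumTo j (λ i → μ (j ∸ i) * (esym i z * esym j z)))

-- The proof is an induction on the number of variables in which μ is
-- generalised.  Both sides are linear in μ, and both obey the same
-- recursion when a variable x (with inverse y) is added in front of z:
--
--   W_μ(x ∷ z)   = (1 + x²)   W_μ(z)   + x · ∂W(μ),
--   RHS_μ(x ∷ z) = (x y + x²) RHS_μ(z) + x · ∂RHS(μ),
--   with ∂F(μ) = F_{μ→}(z) + F_{μ←}(z) + F_{δ(μ₀)}(z).
--
-- Here μ→ / μ← shift μ right / left and δ(c) is the sequence with the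
-- single entry c in position 1.  For W this comes from e_i(x ∷ z) =
-- e_i(z) + x e_{i-1}(z), after writing W as a bilinear form built from
-- the truncated convolution μ ⋆ e.  For the right-hand side it comes from
-- the three-term recursion γ_{k+1}(μ) = γ_k(μ→) + γ_k(μ←) + γ_k(δ(μ₀)),
-- which is Pascal's rule once γ_k is written as a sum over the
-- antidiagonal a + b = ⌊k/2⌋ (split by the parity of k).
module Submission where

open import Defs
open import Level using (Level)
open import Data.Nat using (ℕ; _∸_; _≤_)
open import Data.Fin using (Fin)
open import Data.Vec using (Vec; lookup; zipWith)
open import Algebra.Bundles using (CommutativeRing)

open import Data.Nat using (zero; suc; z≤n; s≤s; _<_; ⌊_/2⌋) renaming (_+_ to _+ℕ_; _*_ to _*ℕ_)
import Data.Nat.Properties as ℕₚ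
open import Data.Nat.Combinatorics using (_C_; nCk≡nC[n∸k]; nCk+nC[k+1]≡[n+1]C[k+1])
open import Data.Vec using ([]; _∷_)
open import Data.Fin using () renaming (zero to fzero; suc to fsuc)
open import Relation.Binary.PropositionalEquality as ≡ using (_≡_)
open import Function using (_∘_)

-- Doubling by recursion, so that parity can be read off by pattern matching.
double : ℕ → ℕ
double zero = zero
double (suc n) = suc (suc (double n))

data Parity : ℕ → Set where
  even : ∀ h → Parity (double h)
  odd  : ∀ h → Parity (suc (double h))

parity : ∀ k → Parity k
parity zero = even zero
parity (suc k) with parity k
... | even h = odd h
... | odd h = even (suc h)

double≡2* : ∀ j → 2 *ℕ j ≡ double j
double≡2* zero = ≡.refl
double≡2* (suc j) = ≡.cong suc (≡.trans (ℕₚ.+-suc j (j +ℕ 0)) (≡.cong suc (double≡2* j)))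

double≡+ : ∀ h → double h ≡ h +ℕ h
double≡+ zero = ≡.refl
double≡+ (suc h) = ≡.cong suc (≡.trans (≡.cong suc (double≡+ h)) (≡.sym (ℕₚ.+-suc h h)))

double-∸ : ∀ h j → double h ∸ double j ≡ double (h ∸ j)
double-∸ h zero = ≡.refl
double-∸ zero (suc j) = ≡.refl
double-∸ (suc h) (suc j) = double-∸ h j

suc-double-∸ : ∀ h j → j ≤ h → suc (double h) ∸ double j ≡ suc (double (h ∸ j))
suc-double-∸ h zero _ = ≡.refl
suc-double-∸ (suc h) (suc j) (s≤s j≤h) = suc-double-∸ h j j≤h

⌊double/2⌋ : ∀ h → ⌊ double h /2⌋ ≡ h
⌊double/2⌋ zero = ≡.refl
⌊double/2⌋ (suc h) = ≡.cong suc (⌊double/2⌋ h)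

⌊suc-double/2⌋ : ∀ h → ⌊ suc (double h) /2⌋ ≡ h
⌊suc-double/2⌋ zero = ≡.refl
⌊suc-double/2⌋ (suc h) = ≡.cong suc (⌊suc-double/2⌋ h)

suc-∸ : ∀ {i j} → i ≤ j → suc j ∸ i ≡ suc (j ∸ i)
suc-∸ i≤j = ℕₚ.+-∸-assoc 1 i≤j

middle-binomial : ∀ h → suc (double h) C suc h ≡ suc (double h) C h
middle-binomial h = ≡.trans (nCk≡nC[n∸k] h+1≤2h+1) (≡.cong (suc (double h) C_) 2h+1∸h+1≡h)
  where
  h+1≤2h+1 : suc h ≤ suc (double h)
  h+1≤2h+1 = s≤s (≡.subst (h ≤_) (≡.sym (double≡+ h)) (ℕₚ.m≤m+n h h))
  2h+1∸h+1≡h : suc (double h) ∸ suc h ≡ h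
  2h+1∸h+1≡h = ≡.trans (≡.cong (_∸ h) (double≡+ h)) (ℕₚ.m+n∸m≡n h h)

C-pred : ℕ → ℕ → ℕ
C-pred n zero = 0
C-pred n (suc a) = n C a

pascal : ∀ n a → suc n C a ≡ n C a +ℕ C-pred n a
pascal n zero = ≡.refl
pascal n (suc a) = ≡.trans (≡.sym (nCk+nC[k+1]≡[n+1]C[k+1] n a)) (ℕₚ.+-comm (n C a) (n C suc a))

module _ {c ℓ : Level} (R : CommutativeRing c ℓ) where
  open CommutativeRing R hiding (zero)
  open import Relation.Binary.Reasoning.Setoid setoid
  open import Algebra.Solver.Ring.NaturalCoefficients.Default commutativeSemiring
    using (solve; _:=_; _:+_; _:*_)
  open import Algebra.Properties.CommutativeSemigroup +-commutativeSemigroup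
    using () renaming (interchange to +-interchange)

  *-distrib-scaled : ∀ m a x b → m * (a + x * b) ≈ m * a + x * (m * b)
  *-distrib-scaled = solve 4 (λ m a x b → (m :* (a :+ (x :* b))) := ((m :* a) :+ (x :* (m :* b)))) refl

  +-drop-0ʳ : ∀ {a b} → b ≈ 0# → a + b ≈ a
  +-drop-0ʳ b≈0 = trans (+-congˡ b≈0) (+-identityʳ _)

  +-drop-0ˡ : ∀ {a b} → a ≈ 0# → a + b ≈ b
  +-drop-0ˡ a≈0 = trans (+-congʳ a≈0) (+-identityˡ _)

  Σ≤ : ℕ → (ℕ → Carrier) → Carrier
  Σ≤ = sumTo R

  Σ-cong : ∀ m {f g : ℕ → Carrier} → (∀ i → i ≤ m → f i ≈ g i) → Σ≤ m f ≈ Σ≤ m g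
  Σ-cong zero f≈g = f≈g 0 z≤n
  Σ-cong (suc m) f≈g = +-cong (Σ-cong m (λ i i≤m → f≈g i (ℕₚ.m≤n⇒m≤1+n i≤m))) (f≈g (suc m) ℕₚ.≤-refl)

  Σ-cong′ : ∀ m {f g : ℕ → Carrier} → (∀ i → f i ≈ g i) → Σ≤ m f ≈ Σ≤ m g
  Σ-cong′ m f≈g = Σ-cong m (λ i _ → f≈g i)

  Σ-bound : ∀ {m m′} f → m ≡ m′ → Σ≤ m f ≈ Σ≤ m′ f
  Σ-bound f ≡.refl = refl

  Σ-+ : ∀ m f g → Σ≤ m (λ i → f i + g i) ≈ Σ≤ m f + Σ≤ m g
  Σ-+ zero f g = refl
  Σ-+ (suc m) f g = trans (+-congʳ (Σ-+ m f g)) (+-interchange _ _ _ _)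

  Σ-*ˡ : ∀ m x f → Σ≤ m (λ i → x * f i) ≈ x * Σ≤ m f
  Σ-*ˡ zero x f = refl
  Σ-*ˡ (suc m) x f = trans (+-congʳ (Σ-*ˡ m x f)) (sym (distribˡ x (Σ≤ m f) (f (suc m))))

  Σ-*ʳ : ∀ m x f → Σ≤ m (λ i → f i * x) ≈ Σ≤ m f * x
  Σ-*ʳ m x f = trans (Σ-cong′ m (λ i → *-comm _ _)) (trans (Σ-*ˡ m x f) (*-comm _ _))

  Σ-0 : ∀ m f → (∀ i → f i ≈ 0#) → Σ≤ m f ≈ 0#
  Σ-0 zero f f≈0 = f≈0 0
  Σ-0 (suc m) f f≈0 = trans (+-cong (Σ-0 m f f≈0) (f≈0 (suc m))) (+-identityˡ 0#)

  Σ-head : ∀ m f → Σ≤ (suc m) f ≈ f 0 + Σ≤ m (f ∘ suc)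
  Σ-head zero f = refl
  Σ-head (suc m) f = trans (+-congʳ (Σ-head m f)) (+-assoc _ _ _)

  Σ-head-0 : ∀ m f → f 0 ≈ 0# → Σ≤ (suc m) f ≈ Σ≤ m (f ∘ suc)
  Σ-head-0 m f f0≈0 = trans (Σ-head m f) (+-drop-0ˡ f0≈0)

  -- Antidiagonal sums  AD h F = Σ_{a + b = h} F a b.  Writing γ_k in this
  -- form removes the truncated subtraction k ∸ 2j from its indices.

  AD : ℕ → (ℕ → ℕ → Carrier) → Carrier
  AD zero F = F 0 0
  AD (suc h) F = F 0 (suc h) + AD h (λ a b → F (suc a) b)

  AD-b0 : ∀ h F → AD (suc h) F ≈ AD h (λ a b → F a (suc b)) + F (suc h) 0
  AD-b0 zero F = refl
  AD-b0 (suc h) F = trans (+-congˡ (AD-b0 h (λ a b → F (suc a) b))) (sym (+-assoc _ _ _))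

  AD-cong : ∀ h {F G} → (∀ a b → F a b ≈ G a b) → AD h F ≈ AD h G
  AD-cong zero F≈G = F≈G 0 0
  AD-cong (suc h) F≈G = +-cong (F≈G 0 (suc h)) (AD-cong h (λ a b → F≈G (suc a) b))

  AD-+ : ∀ h F G → AD h (λ a b → F a b + G a b) ≈ AD h F + AD h G
  AD-+ zero F G = refl
  AD-+ (suc h) F G = trans (+-congˡ (AD-+ h _ _)) (+-interchange _ _ _ _)

  AD-0 : ∀ h F → (∀ a b → F a b ≈ 0#) → AD h F ≈ 0#
  AD-0 zero F F≈0 = F≈0 0 0
  AD-0 (suc h) F F≈0 = trans (+-cong (F≈0 0 (suc h)) (AD-0 h _ (λ a b → F≈0 (suc a) b))) (+-identityˡ 0#)

  AD-only-b0 : ∀ h F → (∀ a b → F a (suc b) ≈ 0#) → AD h F ≈ F h 0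
  AD-only-b0 zero F _ = refl
  AD-only-b0 (suc h) F F≈0 = trans (AD-b0 h F) (+-drop-0ˡ (AD-0 h _ F≈0))

  Σ-AD : ∀ h F → Σ≤ h (λ j → F j (h ∸ j)) ≈ AD h F
  Σ-AD zero F = refl
  Σ-AD (suc h) F =
    trans (+-cong (Σ-cong h (λ j j≤h → reflexive (≡.cong (F j) (suc-∸ j≤h))))
                  (reflexive (≡.cong (F (suc h)) (ℕₚ.n∸n≡0 h))))
          (trans (+-congʳ (Σ-AD h (λ a b → F a (suc b)))) (sym (AD-b0 h F)))

  -- μ→ : (μ→)₀ = 0, (μ→)_{i+1} = μ_i.  The left shift μ← is μ ∘ suc.
  shiftR : (ℕ → Carrier) → ℕ → Carrier
  shiftR f zero = 0#
  shiftR f (suc i) = f i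

  atZero : Carrier → ℕ → Carrier
  atZero c zero = c
  atZero c (suc _) = 0#

  -- ∂Φ(μ) = Φ(μ→) + Φ(μ←) + Φ(δ(μ₀)), with δ(c) = (atZero c)→: the common
  -- shape of the recursions for W and for γ.
  ∂ : ((ℕ → Carrier) → Carrier) → (ℕ → Carrier) → Carrier
  ∂ Φ μ = Φ (shiftR μ) + Φ (μ ∘ suc) + Φ (shiftR (atZero (μ 0)))

  esym-vanish : ∀ {n} (v : Vec Carrier n) k → n < k → esym R k v ≈ 0#
  esym-vanish [] (suc k) _ = refl
  esym-vanish (x ∷ v) (suc k) (s≤s n<k) =
    trans (+-cong (esym-vanish v (suc k) (ℕₚ.m<n⇒m<1+n n<k))
                  (trans (*-congˡ (esym-vanish v k n<k)) (zeroʳ x)))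
          (+-identityˡ 0#)

  esym-top : ∀ {n} x (v : Vec Carrier n) → esym R (suc n) (x ∷ v) ≈ x * esym R n v
  esym-top {n} x v = +-drop-0ˡ (esym-vanish v (suc n) (ℕₚ.n<1+n n))

  esym-∷ : ∀ {n} x (v : Vec Carrier n) i → esym R i (x ∷ v) ≈ esym R i v + x * shiftR (λ k → esym R k v) i
  esym-∷ x v zero = sym (trans (+-congˡ (zeroʳ x)) (+-identityʳ _))
  esym-∷ x v (suc i) = refl

  -- The recursion for W

  _⋆_ : (ℕ → Carrier) → (ℕ → Carrier) → ℕ → Carrier
  (μ ⋆ f) j = Σ≤ j (λ i → μ (j ∸ i) * f i)

  ⋆-suc : ∀ μ f j → (μ ⋆ f) (suc j) ≈ ((μ ∘ suc) ⋆ f) j + μ 0 * f (suc j)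
  ⋆-suc μ f j = +-cong (Σ-cong j (λ i i≤j → *-congʳ (reflexive (≡.cong μ (suc-∸ i≤j)))))
                       (*-congʳ (reflexive (≡.cong μ (ℕₚ.n∸n≡0 j))))

  ⋆-shiftR : ∀ μ f j → (μ ⋆ shiftR f) (suc j) ≈ (μ ⋆ f) j
  ⋆-shiftR μ f j = Σ-head-0 j _ (zeroʳ _)

  shiftR-⋆ : ∀ μ f j → (shiftR μ ⋆ f) j ≈ (μ ⋆ shiftR f) j
  shiftR-⋆ μ f zero = trans (zeroˡ _) (sym (zeroʳ _))
  shiftR-⋆ μ f (suc j) =
    trans (⋆-suc (shiftR μ) f j)
          (trans (+-drop-0ʳ (zeroˡ _)) (sym (⋆-shiftR μ f j)))

  atZero-⋆ : ∀ c f j → (atZero c ⋆ f) j ≈ c * f j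
  atZero-⋆ c f zero = refl
  atZero-⋆ c f (suc j) = trans (⋆-suc (atZero c) f j) (+-drop-0ˡ (Σ-0 j _ (λ _ → zeroˡ _)))

  ⋆-cong : ∀ μ {f g} → (∀ i → f i ≈ g i) → ∀ j → (μ ⋆ f) j ≈ (μ ⋆ g) j
  ⋆-cong μ f≈g j = Σ-cong′ j (λ i → *-congˡ (f≈g i))

  ⋆-linear : ∀ μ f g x j → (μ ⋆ (λ i → f i + x * g i)) j ≈ (μ ⋆ f) j + x * (μ ⋆ g) j
  ⋆-linear μ f g x j = trans (Σ-cong′ j (λ i → *-distrib-scaled (μ (j ∸ i)) (f i) x (g i)))
                             (trans (Σ-+ j _ _) (+-congˡ (Σ-*ˡ j x _)))

  form : (ℕ → Carrier) → ℕ → (ℕ → Carrier) → (ℕ → Carrier) → Carrier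
  form μ N f g = Σ≤ N (λ j → (μ ⋆ f) j * g j)

  W-form : ∀ μ n (z : Vec Carrier n) → W R μ n z ≈ form μ n (λ i → esym R i z) (λ j → esym R j z)
  W-form μ n z = Σ-cong′ n (λ j → trans (Σ-cong′ j (λ i → sym (*-assoc _ _ _))) (Σ-*ʳ j _ _))


  form-cong : ∀ μ N {f f′ g g′} → (∀ i → f i ≈ f′ i) → (∀ i → g i ≈ g′ i) → form μ N f g ≈ form μ N f′ g′
  form-cong μ N f≈f′ g≈g′ = Σ-cong′ N (λ j → *-cong (⋆-cong μ f≈f′ j) (g≈g′ j))

  form-last-0 : ∀ μ N f g → g (suc N) ≈ 0# → form μ (suc N) f g ≈ form μ N f g
  form-last-0 μ N f g gN≈0 = +-drop-0ʳ (trans (*-congˡ gN≈0) (zeroʳ _))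

  form-bilinear : ∀ μ N f f′ g g′ x →
    form μ N (λ i → f i + x * f′ i) (λ j → g j + x * g′ j)
      ≈ form μ N f g + x * (form μ N f′ g + form μ N f g′) + (x * x) * form μ N f′ g′
  form-bilinear μ N f f′ g g′ x = begin
    form μ N (λ i → f i + x * f′ i) (λ j → g j + x * g′ j)
      ≈⟨ Σ-cong′ N (λ j → trans (*-congʳ (⋆-linear μ f f′ x j)) (expand _ _ _ _)) ⟩
    Σ≤ N (λ j → ((μ ⋆ f) j * g j + x * ((μ ⋆ f′) j * g j + (μ ⋆ f) j * g′ j)) + (x * x) * ((μ ⋆ f′) j * g′ j))
      ≈⟨ Σ-+ N _ _ ⟩
    Σ≤ N (λ j → (μ ⋆ f) j * g j + x * ((μ ⋆ f′) j * g j + (μ ⋆ f) j * g′ j))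
      + Σ≤ N (λ j → (x * x) * ((μ ⋆ f′) j * g′ j))
      ≈⟨ +-cong (trans (Σ-+ N _ _) (+-congˡ (trans (Σ-*ˡ N x _) (*-congˡ (Σ-+ N _ _))))) (Σ-*ˡ N _ _) ⟩
    form μ N f g + x * (form μ N f′ g + form μ N f g′) + (x * x) * form μ N f′ g′ ∎
    where
    expand : ∀ A A′ B B′ → (A + x * A′) * (B + x * B′) ≈ A * B + x * (A′ * B + A * B′) + (x * x) * (A′ * B′)
    expand A A′ B B′ =
      solve 5 (λ A A′ B B′ x → ((A :+ (x :* A′)) :* (B :+ (x :* B′)))
                            := (((A :* B) :+ (x :* ((A′ :* B) :+ (A :* B′)))) :+ ((x :* x) :* (A′ :* B′))))
            refl A A′ B B′ x

  form-shiftRˡ : ∀ μ N f g → form μ N (shiftR f) g ≈ form (shiftR μ) N f g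
  form-shiftRˡ μ N f g = Σ-cong′ N (λ j → *-congʳ (sym (shiftR-⋆ μ f j)))

  form-shiftR² : ∀ μ N f g → form μ (suc N) (shiftR f) (shiftR g) ≈ form μ N f g
  form-shiftR² μ N f g = trans (Σ-head-0 N _ (zeroʳ _)) (Σ-cong′ N (λ j → *-congʳ (⋆-shiftR μ f j)))

  form-shiftRʳ : ∀ μ N f g →
    form μ (suc N) f (shiftR g) ≈ form (μ ∘ suc) N f g + μ 0 * Σ≤ N (λ j → f (suc j) * g j)
  form-shiftRʳ μ N f g =
    trans (Σ-head-0 N _ (zeroʳ _))
          (trans (Σ-cong′ N (λ j → trans (*-congʳ (⋆-suc μ f j)) (distribʳ (g j) _ _)))
                 (trans (Σ-+ N _ _) (+-congˡ (trans (Σ-cong′ N (λ _ → *-assoc _ _ _)) (Σ-*ˡ N _ _)))))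

  form-atZero : ∀ c N f g → form (atZero c) N f g ≈ c * Σ≤ N (λ j → f j * g j)
  form-atZero c N f g = trans (Σ-cong′ N (λ j → trans (*-congʳ (atZero-⋆ c f j)) (*-assoc _ _ _))) (Σ-*ˡ N c _)

  Σ-adjacent : ∀ h N → Σ≤ N (λ j → h (suc j) * h j) ≈ Σ≤ N (λ j → shiftR h j * h j) + h (suc N) * h N
  Σ-adjacent h zero = sym (+-drop-0ˡ (zeroˡ _))
  Σ-adjacent h (suc N) = trans (+-congʳ (Σ-adjacent h N)) (+-congʳ (+-congˡ (*-comm _ _)))

  W-∷ : ∀ μ n x (z : Vec Carrier n) →
    W R μ (suc n) (x ∷ z) ≈ W R μ n z + (x * x) * W R μ n z + x * ∂ (λ ν → W R ν n z) μ
  W-∷ μ n x z = begin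
    W R μ (suc n) (x ∷ z)
      ≈⟨ W-form μ (suc n) (x ∷ z) ⟩
    form μ (suc n) (λ i → esym R i (x ∷ z)) (λ j → esym R j (x ∷ z))
      ≈⟨ form-cong μ (suc n) (esym-∷ x z) (esym-∷ x z) ⟩
    form μ (suc n) (λ i → e i + x * shiftR e i) (λ j → e j + x * shiftR e j)
      ≈⟨ form-bilinear μ (suc n) e (shiftR e) e (shiftR e) x ⟩
    form μ (suc n) e e + x * (form μ (suc n) (shiftR e) e + form μ (suc n) e (shiftR e))
      + (x * x) * form μ (suc n) (shiftR e) (shiftR e)
      ≈⟨ +-cong (+-cong (form-last-0 μ n e e e₍n+1₎≈0)
                        (*-congˡ (+-cong (trans (form-shiftRˡ μ (suc n) e e) (form-last-0 (shiftR μ) n e e e₍n+1₎≈0))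
                                         (form-shiftRʳ μ n e e))))
                (*-congˡ (form-shiftR² μ n e e)) ⟩
    Wμ + x * (Wμ→ + (Wμ← + μ 0 * T)) + (x * x) * Wμ
      ≈⟨ rearrange Wμ x Wμ→ Wμ← (μ 0) T ⟩
    Wμ + (x * x) * Wμ + x * (Wμ→ + Wμ← + μ 0 * T)
      ≈⟨ sym (+-cong (+-cong (W-form μ n z) (*-congˡ (W-form μ n z)))
                     (*-congˡ (+-cong (+-cong (W-form (shiftR μ) n z) (W-form (μ ∘ suc) n z)) W-δ))) ⟩
    W R μ n z + (x * x) * W R μ n z + x * ∂ (λ ν → W R ν n z) μ ∎
    where
    e : ℕ → Carrier
    e k = esym R k z
    e₍n+1₎≈0 : e (suc n) ≈ 0#
    e₍n+1₎≈0 = esym-vanish z (suc n) (ℕₚ.n<1+n n)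
    Wμ Wμ→ Wμ← T : Carrier
    Wμ = form μ n e e
    Wμ→ = form (shiftR μ) n e e
    Wμ← = form (μ ∘ suc) n e e
    T = Σ≤ n (λ j → e (suc j) * e j)
    W-δ : W R (shiftR (atZero (μ 0))) n z ≈ μ 0 * T
    W-δ = begin
      W R (shiftR (atZero (μ 0))) n z           ≈⟨ W-form (shiftR (atZero (μ 0))) n z ⟩
      form (shiftR (atZero (μ 0))) n e e        ≈⟨ sym (form-shiftRˡ (atZero (μ 0)) n e e) ⟩
      form (atZero (μ 0)) n (shiftR e) e        ≈⟨ form-atZero (μ 0) n (shiftR e) e ⟩
      μ 0 * Σ≤ n (λ j → shiftR e j * e j)       ≈⟨ *-congˡ (sym (trans (Σ-adjacent e n) top≈0)) ⟩
      μ 0 * T                                   ∎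
      where
      top≈0 : Σ≤ n (λ j → shiftR e j * e j) + e (suc n) * e n ≈ Σ≤ n (λ j → shiftR e j * e j)
      top≈0 = +-drop-0ʳ (trans (*-congʳ e₍n+1₎≈0) (zeroˡ _))
    rearrange : ∀ a x b c m t → a + x * (b + (c + m * t)) + (x * x) * a ≈ a + (x * x) * a + x * (b + c + m * t)
    rearrange = solve 6 (λ a x b c m t → ((a :+ (x :* (b :+ (c :+ (m :* t))))) :+ ((x :* x) :* a))
                                      := ((a :+ ((x :* x) :* a)) :+ (x :* ((b :+ c) :+ (m :* t))))) refl

  -- The three-term recursion for γ

  fromℕ-+ : ∀ m n → fromℕ R (m +ℕ n) ≈ fromℕ R m + fromℕ R n
  fromℕ-+ zero n = sym (+-identityˡ _)
  fromℕ-+ (suc m) n = trans (+-congˡ (fromℕ-+ m n)) (sym (+-assoc _ _ _))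

  binom : ℕ → ℕ → Carrier
  binom n a = fromℕ R (n C a)

  pascal-R : ∀ n a → binom (suc n) a ≈ binom n a + fromℕ R (C-pred n a)
  pascal-R n a = trans (reflexive (≡.cong (fromℕ R) (pascal n a))) (fromℕ-+ (n C a) (C-pred n a))

  γ-even : ∀ μ h → gamma R μ (double h) ≈ AD h (λ a b → binom (double h) a * μ (double b))
  γ-even μ h =
    trans (Σ-bound _ (⌊double/2⌋ h))
          (trans (Σ-cong′ h (λ j → *-congˡ (reflexive (≡.cong μ (index j)))))
                 (Σ-AD h (λ a b → binom (double h) a * μ (double b))))
    where
    index : ∀ j → double h ∸ 2 *ℕ j ≡ double (h ∸ j)
    index j = ≡.trans (≡.cong (double h ∸_) (double≡2* j)) (double-∸ h j)

  γ-odd : ∀ μ h → gamma R μ (suc (double h)) ≈ AD h (λ a b → binom (suc (double h)) a * μ (suc (double b)))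
  γ-odd μ h =
    trans (Σ-bound _ (⌊suc-double/2⌋ h))
          (trans (Σ-cong h (λ j j≤h → *-congˡ (reflexive (≡.cong μ (index j j≤h)))))
                 (Σ-AD h (λ a b → binom (suc (double h)) a * μ (suc (double b)))))
    where
    index : ∀ j → j ≤ h → suc (double h) ∸ 2 *ℕ j ≡ suc (double (h ∸ j))
    index j j≤h = ≡.trans (≡.cong (suc (double h) ∸_) (double≡2* j)) (suc-double-∸ h j j≤h)

  AD-shiftR-even : ∀ μ n h →
    AD h (λ a b → binom n a * shiftR μ (double b)) ≈ AD h (λ a b → fromℕ R (C-pred n a) * μ (suc (double b)))
  AD-shiftR-even μ n zero = trans (zeroʳ _) (sym (zeroˡ _))
  AD-shiftR-even μ n (suc h) =
    trans (AD-b0 h (λ a b → binom n a * shiftR μ (double b)))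
          (trans (+-drop-0ʳ (zeroʳ _)) (sym (+-drop-0ˡ (zeroˡ _))))

  AD-pascal : ∀ n h (g : ℕ → Carrier) →
    AD h (λ a b → binom (suc n) a * g b)
      ≈ AD h (λ a b → binom n a * g b) + AD h (λ a b → fromℕ R (C-pred n a) * g b)
  AD-pascal n h g = trans (AD-cong h (λ a b → trans (*-congʳ (pascal-R n a)) (distribʳ (g b) _ _))) (AD-+ h _ _)

  γ-∂-even : ∀ μ h → gamma R μ (suc (double h)) ≈ ∂ (λ ν → gamma R ν (double h)) μ
  γ-∂-even μ h = begin
    gamma R μ (suc (double h))
      ≈⟨ γ-odd μ h ⟩
    AD h (λ a b → binom (suc n) a * μ (suc (double b)))
      ≈⟨ AD-pascal n h (λ b → μ (suc (double b))) ⟩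
    AD h (λ a b → binom n a * μ (suc (double b))) + AD h (λ a b → fromℕ R (C-pred n a) * μ (suc (double b)))
      ≈⟨ trans (+-comm _ _) (sym (+-identityʳ _)) ⟩
    AD h (λ a b → fromℕ R (C-pred n a) * μ (suc (double b))) + AD h (λ a b → binom n a * μ (suc (double b))) + 0#
      ≈⟨ sym (+-cong (+-cong (trans (γ-even (shiftR μ) h) (AD-shiftR-even μ n h)) (γ-even (μ ∘ suc) h))
                     (trans (γ-even (shiftR (atZero (μ 0))) h) (AD-0 h _ impulse-vanishes))) ⟩
    ∂ (λ ν → gamma R ν (double h)) μ ∎
    where
    n = double h
    impulse-vanishes : ∀ a b → binom n a * shiftR (atZero (μ 0)) (double b) ≈ 0#
    impulse-vanishes a zero = zeroʳ _
    impulse-vanishes a (suc b) = zeroʳ _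

  γ-∂-odd : ∀ μ h → gamma R μ (suc (suc (double h))) ≈ ∂ (λ ν → gamma R ν (suc (double h))) μ
  γ-∂-odd μ h = begin
    gamma R μ (double (suc h))
      ≈⟨ γ-even μ (suc h) ⟩
    AD (suc h) (λ a b → binom (suc n) a * μ (double b))
      ≈⟨ AD-pascal n (suc h) (μ ∘ double) ⟩
    AD (suc h) (λ a b → binom n a * μ (double b)) + AD (suc h) (λ a b → fromℕ R (C-pred n a) * μ (double b))
      ≈⟨ +-cong (trans (AD-b0 h (λ a b → binom n a * μ (double b))) (+-congˡ (*-congʳ (reflexive (≡.cong (fromℕ R) (middle-binomial h))))))
                (+-drop-0ˡ (zeroˡ _)) ⟩
    (AD h (λ a b → binom n a * μ (suc (suc (double b)))) + binom n h * μ 0) + AD h (λ a b → binom n a * μ (double b))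
      ≈⟨ rotate _ _ _ ⟩
    AD h (λ a b → binom n a * μ (double b)) + AD h (λ a b → binom n a * μ (suc (suc (double b)))) + binom n h * μ 0
      ≈⟨ sym (+-cong (+-cong (γ-odd (shiftR μ) h) (γ-odd (μ ∘ suc) h))
                     (trans (γ-odd (shiftR (atZero (μ 0))) h) (AD-only-b0 h _ (λ a b → zeroʳ _)))) ⟩
    ∂ (λ ν → gamma R ν (suc (double h))) μ ∎
    where
    n = suc (double h)
    rotate : ∀ x y z → (x + y) + z ≈ z + x + y
    rotate = solve 3 (λ x y z → ((x :+ y) :+ z) := ((z :+ x) :+ y)) refl

  γ-∂ : ∀ μ k → gamma R μ (suc k) ≈ ∂ (λ ν → gamma R ν k) μ
  γ-∂ μ k with parity k
  ... | even h = γ-∂-even μ h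
  ... | odd h = γ-∂-odd μ h

  -- The recursion for the right-hand side

  rhsSum : ℕ → (ℕ → Carrier) → ∀ {n} → Vec Carrier n → Carrier
  rhsSum m c v = Σ≤ m (λ k → c k * esym R (m ∸ k) v)

  rhsSum-cong : ∀ m {c c′} {n} (v : Vec Carrier n) → (∀ k → c k ≈ c′ k) → rhsSum m c v ≈ rhsSum m c′ v
  rhsSum-cong m v c≈c′ = Σ-cong′ m (λ k → *-congʳ (c≈c′ k))

  rhsSum-+ : ∀ m a b {n} (v : Vec Carrier n) → rhsSum m (λ k → a k + b k) v ≈ rhsSum m a v + rhsSum m b v
  rhsSum-+ m a b v = trans (Σ-cong′ m (λ k → distribʳ _ _ _)) (Σ-+ m _ _)

  rhsSum-∷ : ∀ m c t {n} (v : Vec Carrier n) → rhsSum (suc m) c (t ∷ v) ≈ rhsSum (suc m) c v + t * rhsSum m c v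
  rhsSum-∷ m c t v =
    trans (+-cong lower-terms (*-congˡ (trans (e₀ (t ∷ v)) (sym (e₀ v))))) (regroup _ _ _ _)
    where
    e₀ : ∀ {n} (u : Vec Carrier n) → esym R (m ∸ m) u ≈ 1#
    e₀ u = reflexive (≡.cong (λ i → esym R i u) (ℕₚ.n∸n≡0 m))
    term : ∀ k → k ≤ m →
      c k * esym R (suc m ∸ k) (t ∷ v) ≈ c k * esym R (suc m ∸ k) v + t * (c k * esym R (m ∸ k) v)
    term k k≤m = begin
      c k * esym R (suc m ∸ k) (t ∷ v)                   ≡⟨ ≡.cong (λ i → c k * esym R i (t ∷ v)) (suc-∸ k≤m) ⟩
      c k * (esym R (suc (m ∸ k)) v + t * esym R (m ∸ k) v) ≈⟨ *-distrib-scaled (c k) _ t _ ⟩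
      c k * esym R (suc (m ∸ k)) v + t * (c k * esym R (m ∸ k) v)
        ≡⟨ ≡.cong (λ i → c k * esym R i v + t * (c k * esym R (m ∸ k) v)) (≡.sym (suc-∸ k≤m)) ⟩
      c k * esym R (suc m ∸ k) v + t * (c k * esym R (m ∸ k) v) ∎
    lower-terms : Σ≤ m (λ k → c k * esym R (suc m ∸ k) (t ∷ v))
                    ≈ Σ≤ m (λ k → c k * esym R (suc m ∸ k) v) + t * rhsSum m c v
    lower-terms = trans (Σ-cong m term) (trans (Σ-+ m _ _) (+-congˡ (Σ-*ˡ m t _)))
    regroup : ∀ x t u y → (x + t * u) + y ≈ (x + y) + t * u
    regroup = solve 4 (λ x t u y → ((x :+ (t :* u)) :+ y) := ((x :+ y) :+ (t :* u))) refl

  rhsSum-∷-top : ∀ n c t (v : Vec Carrier n) → rhsSum (suc n) c (t ∷ v) ≈ rhsSum n (c ∘ suc) v + t * rhsSum n c v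
  rhsSum-∷-top n c t v =
    trans (rhsSum-∷ n c t v)
          (+-congʳ (Σ-head-0 n _ (trans (*-congˡ (esym-vanish v (suc n) (ℕₚ.n<1+n n))) (zeroʳ _))))

  RHS : (ℕ → Carrier) → ∀ {n} → Vec Carrier n → Vec Carrier n → Carrier
  RHS μ {n} z z′ = esym R n z * rhsSum n (gamma R μ) (zipWith _+_ z z′)

  RHS-∷ : ∀ μ {n} x y (z z′ : Vec Carrier n) →
    RHS μ (x ∷ z) (y ∷ z′) ≈ (x * x) * RHS μ z z′ + (x * y) * RHS μ z z′ + x * ∂ (λ ν → RHS ν z z′) μ
  RHS-∷ μ {n} x y z z′ = begin
    esym R (suc n) (x ∷ z) * rhsSum (suc n) (gamma R μ) (x + y ∷ w)
      ≈⟨ *-cong (esym-top x z) (rhsSum-∷-top n (gamma R μ) (x + y) w) ⟩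
    (x * e) * (rhsSum n (λ k → gamma R μ (suc k)) w + (x + y) * rhsSum n (gamma R μ) w)
      ≈⟨ *-congˡ (+-congʳ (trans (rhsSum-cong n w (γ-∂ μ))
                                 (trans (rhsSum-+ n _ _ w) (+-congʳ (rhsSum-+ n _ _ w))))) ⟩
    (x * e) * ((rhsSum n (gamma R (shiftR μ)) w + rhsSum n (gamma R (μ ∘ suc)) w
                 + rhsSum n (gamma R (shiftR (atZero (μ 0)))) w) + (x + y) * rhsSum n (gamma R μ) w)
      ≈⟨ expand x y e _ _ _ _ ⟩
    (x * x) * RHS μ z z′ + (x * y) * RHS μ z z′ + x * ∂ (λ ν → RHS ν z z′) μ ∎
    where
    w = zipWith _+_ z z′
    e = esym R n z
    expand : ∀ x y e a b c u → (x * e) * ((a + b + c) + (x + y) * u) ≈ (x * x) * (e * u) + (x * y) * (e * u) + x * (e * a + e * b + e * c)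
    expand = solve 7 (λ x y e a b c u → ((x :* e) :* (((a :+ b) :+ c) :+ ((x :+ y) :* u)))
                                     := ((((x :* x) :* (e :* u)) :+ ((x :* y) :* (e :* u))) :+ (x :* (((e :* a) :+ (e :* b)) :+ (e :* c))))) refl

  -- Induction on the number of variables, for all μ at once: W and RHS
  -- satisfy the same recursion once x y = 1.
  W≈RHS : ∀ n μ (z z′ : Vec Carrier n) → (∀ i → lookup z i * lookup z′ i ≈ 1#) → W R μ n z ≈ RHS μ z z′
  W≈RHS zero μ [] [] _ = begin
    μ 0 * (1# * 1#)           ≈⟨ trans (*-congˡ (*-identityˡ 1#)) (*-identityʳ _) ⟩
    μ 0                       ≈⟨ sym (trans (*-congʳ (+-identityʳ 1#)) (*-identityˡ _)) ⟩
    (1# + 0#) * μ 0           ≈⟨ sym (trans (*-identityˡ _) (*-identityʳ _)) ⟩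
    1# * (((1# + 0#) * μ 0) * 1#) ∎
  W≈RHS (suc n) μ (x ∷ z) (y ∷ z′) inverse = begin
    W R μ (suc n) (x ∷ z)
      ≈⟨ W-∷ μ n x z ⟩
    W R μ n z + (x * x) * W R μ n z + x * ∂ (λ ν → W R ν n z) μ
      ≈⟨ +-cong (+-cong (IH μ) (*-congˡ (IH μ))) (*-congˡ (+-cong (+-cong (IH (shiftR μ)) (IH (μ ∘ suc))) (IH (shiftR (atZero (μ 0)))))) ⟩
    RHS μ z z′ + (x * x) * RHS μ z z′ + x * ∂ (λ ν → RHS ν z z′) μ
      ≈⟨ +-congʳ (trans (+-comm _ _) (+-congˡ (sym xy·r≈r))) ⟩
    (x * x) * RHS μ z z′ + (x * y) * RHS μ z z′ + x * ∂ (λ ν → RHS ν z z′) μ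
      ≈⟨ sym (RHS-∷ μ x y z z′) ⟩
    RHS μ (x ∷ z) (y ∷ z′) ∎
    where
    IH : ∀ ν → W R ν n z ≈ RHS ν z z′
    IH ν = W≈RHS n ν z z′ (λ i → inverse (fsuc i))
    xy·r≈r : (x * y) * RHS μ z z′ ≈ RHS μ z z′
    xy·r≈r = trans (*-congʳ (inverse fzero)) (*-identityˡ _)

theorem2p1 : {c ℓ : Level} (R : CommutativeRing c ℓ) →
    let open CommutativeRing R in
    (n : ℕ) → 1 ≤ n → (μ : ℕ → Carrier) →
    (z zinv : Vec Carrier n) → (∀ (i : Fin n) → lookup z i * lookup zinv i ≈ 1#) →
    W R μ n z ≈ esym R n z * sumTo R n (λ k → gamma R μ k * esym R (n ∸ k) (zipWith _+_ z zinv))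
theorem2p1 R n _ μ z zinv inverse = W≈RHS R n μ z zinv inverse
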